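{- Let $M\subseteq\mathbb{T}$ satisfy the standing hypothesis. The complete core $\mathrm{core}_{\oplus}(\rho^\forall_M)$ of the universal closure for the next-time transformer $\oplus$ exists, and its set of fixpoints is $\{Y\subseteq\mathbb{T}\mid\forall k\in\mathbb{N}.\ \ominus^k(Y)=\rho^\forall_M(\ominus^k(Y))\}$.
   Context: $\mathbb{T}$ is the set of traces $\langle i,\sigma\rangle$, $i\in\mathbb{Z}$, $\sigma:\mathbb{Z}\to\mathbb{S}$; $X_{\downarrow s}=\{\langle i,\sigma\rangle\in X\mid\sigma_i=s\}$; $\oplus(X)=\{\langle i,\sigma\rangle\mid\langle i+1,\sigma\rangle\in X\}$, $\ominus(X)=\{\langle i,\sigma\rangle\mid\langle i-1,\sigma\rangle\in X\}$, $\curvearrowleft(X)=\{\langle -i,\lambda k.\sigma_{ -k}\rangle\mid\langle i,\sigma\rangle\in X\}$. Standing hypothesis on $M$: (i) $|M_{\downarrow s}|>1$ for all $s$; (ii) $\oplus(M)=M=\ominus(M)$ and $\oplus(\curvearrowleft M)=\curvearrowleft M=\ominus(\curvearrowleft M)$. $\rho^\forall_M(X)=\{\langle i,\sigma\rangle\in M\mid M_{\downarrow\sigma_i}\subseteq X\}$. Upper closure operators on $\langle\wp(\mathbb{T}),\supseteq\rangle$: maps monotone w.r.t. $\subseteq$, idempotent, with $\rho(X)\subseteq X$; ordered by $\rho\sqsubseteq\eta$ iff $\rho(X)\supseteq\eta(X)$ for all $X$; a closure is identified with its set of fixpoints (its image). $\rho$ is complete for $f$ if $\rho\circ f=\rho\circ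 f\circ\rho$. The complete core of $\rho$ for $f$ is the $\sqsubseteq$-least closure $\eta$ with $\rho\sqsubseteq\eta$ complete for $f$. -}

module Defs where

open import Level using (Level; suc)
open import Data.Nat using (ℕ; zero) renaming (suc to sucℕ)
open import Data.Integer using (ℤ; _+_; _-_; -_; 1ℤ)
open import Data.Product using (Σ; Σ-syntax; _×_; _,_)
open import Relation.Binary.PropositionalEquality using (_≡_)
open import Relation.Nullary using (¬_)
open import Relation.Unary using (Pred; _⊆_; _≐_)

Trace : ∀ {ℓ} → Set ℓ → Set ℓ
Trace S = ℤ × (ℤ → S)

TSet : ∀ {ℓ} → Set ℓ → Set (suc ℓ)
TSet {ℓ} S = Pred (Trace S) ℓ

module _ {ℓ} {S : Set ℓ} where

  _↓_ : TSet S → S → TSet S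
  (X ↓ s) (i , σ) = X (i , σ) × σ i ≡ s

  ⊕ : TSet S → TSet S
  ⊕ X (i , σ) = X (i + 1ℤ , σ)

  ⊖ : TSet S → TSet S
  ⊖ X (i , σ) = X (i - 1ℤ , σ)

  -- ↶(X) = { ⟨-i, λk.σ(-k)⟩ | ⟨i,σ⟩ ∈ X }, written as a preimage under the
  -- involution ⟨i,σ⟩ ↦ ⟨-i, λk.σ(-k)⟩ (image = preimage for an involution).
  ↶ : TSet S → TSet S
  ↶ X (i , σ) = X (- i , (λ k → σ (- k)))

  ⊖^ : ℕ → TSet S → TSet S
  ⊖^ zero X = X
  ⊖^ (sucℕ k) X = ⊖ (⊖^ k X)

  _≉ᵗ_ : Trace S → Trace S → Set ℓ
  (i , σ) ≉ᵗ (j , τ) = ¬ (i ≡ j × (∀ k → σ k ≡ τ k))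

  MoreThanOne : TSet S → Set ℓ
  MoreThanOne X = Σ[ t ∈ Trace S ] Σ[ t' ∈ Trace S ] (X t × X t' × t ≉ᵗ t')

  StandingHyp : TSet S → Set ℓ
  StandingHyp M =
    (∀ s → MoreThanOne (M ↓ s))
    × (⊕ M ≐ M) × (⊖ M ≐ M)
    × (⊕ (↶ M) ≐ ↶ M) × (⊖ (↶ M) ≐ ↶ M)

  ρ∀ : TSet S → TSet S → TSet S
  ρ∀ M X (i , σ) = M (i , σ) × ((M ↓ σ i) ⊆ X)

  -- Upper closure operators on ⟨℘(𝕋), ⊇⟩.
  record UCO : Set (suc ℓ) where
    field
      op         : TSet S → TSet S
      monotone   : ∀ {X Y} → X ⊆ Y → op X ⊆ op Y
      idempotent : ∀ X → op (op X) ≐ op X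
      reductive  : ∀ X → op X ⊆ X
  open UCO public

  _⊑_ : (TSet S → TSet S) → (TSet S → TSet S) → Set (suc ℓ)
  ρ ⊑ η = ∀ X → η X ⊆ ρ X

  CompleteFor : (TSet S → TSet S) → (TSet S → TSet S) → Set (suc ℓ)
  CompleteFor ρ f = ∀ X → ρ (f X) ≐ ρ (f (ρ X))

  IsCompleteCore : (TSet S → TSet S) → (TSet S → TSet S) → UCO → Set (suc ℓ)
  IsCompleteCore ρ f η =
    (ρ ⊑ op η) × CompleteFor (op η) f
    × (∀ (η' : UCO) → ρ ⊑ op η' → CompleteFor (op η') f → op η ⊑ op η')

  IsFixpoint : UCO → TSet S → Set ℓ
  IsFixpoint η Y = op η Y ≐ Y

{-# OPTIONS --safe #-}
-- The core is described by reachability.  From a trace ⟨a,σ⟩ one may jump to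
-- ⟨b,τ⟩ whenever, for some k ≥ 0, ⟨b+k,τ⟩ ∈ M and τ(b+k) = σ(a+k): a set Y
-- with ⊖ᵏ(Y) = ρ∀(⊖ᵏ(Y)) for all k lies in M and is closed under these jumps,
-- so the core sends X to the traces all of whose reachable traces lie in M ∩ X.
-- Shifting both ends of a jump one step back gives a jump again (take k+1),
-- which, as M is closed under moving forward in time, makes this closure
-- complete for ⊕.  Conversely the fixpoints of any closure above ρ∀ that is
-- complete for ⊕ are closed under ⊖, hence satisfy the condition for every k;
-- this gives both minimality and the description of the fixpoints.
module Submission where

open import Defs
open import Data.Nat using (ℕ; zero) renaming (suc to sucℕ)
open import Data.Integer using (_+_; _-_; 1ℤ; +_)
open import Data.Integer.Properties using (+-identityʳ)
open import Data.Integer.Tactic.RingSolver using (solve-∀)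
open import Data.Product using (Σ-syntax; _×_; _,_; proj₁; proj₂)
open import Function using (_∘_; id; _⇔_; mk⇔; Equivalence)
open import Function.Construct.Composition using (_⇔-∘_)
open import Relation.Binary using (Rel)
open import Relation.Binary.Construct.Closure.ReflexiveTransitive using (Star; ε; _◅_; _◅◅_; gmap; fold)
open import Relation.Binary.PropositionalEquality using (_≡_; refl; sym; subst; subst₂)
open import Relation.Unary using (_≐_; _⊆_; _∩_)

open Equivalence using (to; from)

private
  -1+1 : ∀ i → i - 1ℤ + 1ℤ ≡ i
  -1+1 = solve-∀

  +1-1 : ∀ i → i + 1ℤ - 1ℤ ≡ i
  +1-1 = solve-∀

  +suc-1 : ∀ i n → i + (1ℤ + n) - 1ℤ ≡ i + n
  +suc-1 = solve-∀

  -1+suc : ∀ i n → i - 1ℤ + (1ℤ + n) ≡ i + n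
  -1+suc = solve-∀

module _ {ℓ} {S : Set ℓ} where

  at-index-cong : ∀ (Z : TSet S) {i j σ} → i ≡ j → Z (i , σ) ⇔ Z (j , σ)
  at-index-cong Z {σ = σ} i≡j =
    mk⇔ (subst (λ i → Z (i , σ)) i≡j) (subst (λ i → Z (i , σ)) (sym i≡j))

  ⊕-mono : ∀ {X Y : TSet S} → X ⊆ Y → ⊕ X ⊆ ⊕ Y
  ⊕-mono X⊆Y = X⊆Y

  ⊖∘⊕⊆id : ∀ (Z : TSet S) → ⊖ (⊕ Z) ⊆ Z
  ⊖∘⊕⊆id Z {i , σ} = to (at-index-cong Z (-1+1 i))

  id⊆⊕∘⊖ : ∀ (Z : TSet S) → Z ⊆ ⊕ (⊖ Z)
  id⊆⊕∘⊖ Z {i , σ} = from (at-index-cong Z (+1-1 i))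

  ⊖^-at : ∀ k (Z : TSet S) {b σ} → ⊖^ k Z (b + + k , σ) ⇔ Z (b , σ)
  ⊖^-at zero     Z {b} = at-index-cong Z (+-identityʳ b)
  ⊖^-at (sucℕ k) Z {b} = ⊖^-at k Z ⇔-∘ at-index-cong (⊖^ k Z) (+suc-1 b (+ k))

  ⊖^-Closed : (TSet S → TSet S) → TSet S → Set ℓ
  ⊖^-Closed ρ Y = ∀ k → ⊖^ k Y ⊆ ρ (⊖^ k Y)

  subcommuting⇒complete : ∀ (η : UCO) {f : TSet S → TSet S} →
    (∀ {X Y} → X ⊆ Y → f X ⊆ f Y) → (∀ X → op η (f X) ⊆ f (op η X)) →
    CompleteFor (op η) f
  subcommuting⇒complete η {f} f-mono ηf⊆fη X =
      monotone η (ηf⊆fη X) ∘ proj₂ (idempotent η (f X))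
    , monotone η (f-mono (reductive η X))

  module _ (η : UCO {S = S}) (complete : CompleteFor (op η) ⊕) where

    ⊖-fixpoint : ∀ {Y} → IsFixpoint η Y → IsFixpoint η (⊖ Y)
    ⊖-fixpoint {Y} (_ , Y⊆ηY) =
      reductive η (⊖ Y) , λ {t} y → ⊖∘⊕⊆id (op η (⊖ Y)) {t} (ηY⊆⊕η⊖Y (Y⊆ηY y))
      where
      ηY⊆⊕η⊖Y : op η Y ⊆ ⊕ (op η (⊖ Y))
      ηY⊆⊕η⊖Y y =
        reductive η (⊕ (op η (⊖ Y))) (proj₁ (complete (⊖ Y)) (monotone η (id⊆⊕∘⊖ Y) y))

    ⊖^-fixpoint : ∀ k {Y} → IsFixpoint η Y → IsFixpoint η (⊖^ k Y)
    ⊖^-fixpoint zero     fixY = fixY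
    ⊖^-fixpoint (sucℕ k) fixY = ⊖-fixpoint (⊖^-fixpoint k fixY)

    fixpoint⇒⊖^-closed : ∀ {ρ} → ρ ⊑ op η → ∀ {Y} → IsFixpoint η Y → ⊖^-Closed ρ Y
    fixpoint⇒⊖^-closed ρ⊑η fixY k = ρ⊑η _ ∘ proj₂ (⊖^-fixpoint k fixY)

  module _ (M : TSet S) where

    ρ∀-reductive : ∀ X → ρ∀ M X ⊆ X
    ρ∀-reductive X {i , σ} (m , M↓⊆X) = M↓⊆X {i , σ} (m , refl)

    data Jump : Rel (Trace S) ℓ where
      jump : ∀ {a σ b τ} k → (M ↓ σ (a + + k)) (b + + k , τ) → Jump (a , σ) (b , τ)

    Reachable : Rel (Trace S) ℓ
    Reachable = Star Jump

    ↓⇒Jump : ∀ {i σ j τ} → (M ↓ σ i) (j , τ) → Jump (i , σ) (j , τ)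
    ↓⇒Jump {i} {σ} {j} {τ} p =
      jump 0 (subst₂ (λ i j → (M ↓ σ i) (j , τ)) (sym (+-identityʳ i)) (sym (+-identityʳ j)) p)

    back : Trace S → Trace S
    back (i , σ) = (i - 1ℤ , σ)

    Jump-back : ∀ {t u} → Jump t u → Jump (back t) (back u)
    Jump-back (jump {a} {σ} {b} {τ} k p) =
      jump (sucℕ k) (subst₂ (λ i j → (M ↓ σ i) (j , τ)) (sym (-1+suc a (+ k))) (sym (-1+suc b (+ k))) p)

    ⊖^-closed⇒Jump-closed : ∀ {Y} → ⊖^-Closed (ρ∀ M) Y → ∀ {t u} → Jump t u → Y t → Y u
    ⊖^-closed⇒Jump-closed {Y} closed (jump k p) y =
      to (⊖^-at k Y) (proj₂ (closed k (from (⊖^-at k Y) y)) p)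

    ⊖^-closed⇒Reachable-closed : ∀ {Y} → ⊖^-Closed (ρ∀ M) Y → ∀ {t u} → Reachable t u → Y t → Y u
    ⊖^-closed⇒Reachable-closed {Y} closed =
      fold (λ t u → Y t → Y u) (λ j Yu→Yw → Yu→Yw ∘ ⊖^-closed⇒Jump-closed closed j) id

    core : TSet S → TSet S
    core X t = ∀ {u} → Reachable t u → (M ∩ X) u

    coreUCO : UCO
    coreUCO = record
      { op         = core
      ; monotone   = λ X⊆Y h r → let (m , x) = h r in m , X⊆Y x
      ; idempotent = λ X → (λ h → proj₂ (h ε)) , λ h r → proj₁ (h r) , λ r′ → h (r ◅◅ r′)
      ; reductive  = λ X h → proj₂ (h ε)
      }

    ρ∀⊑core : ρ∀ M ⊑ core
    ρ∀⊑core X {i , σ} h = proj₁ (h ε) , λ { {j , τ} p → proj₂ (h (↓⇒Jump p ◅ ε)) }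

    ⊖^-closed⇒⊆core : ∀ {Y} → ⊖^-Closed (ρ∀ M) Y → Y ⊆ core Y
    ⊖^-closed⇒⊆core closed y r =
      let y′ = ⊖^-closed⇒Reachable-closed closed r y in proj₁ (closed 0 y′) , y′

    ⊖^-closed⇒core-fixpoint : ∀ {Y} → ⊖^-Closed (ρ∀ M) Y → IsFixpoint coreUCO Y
    ⊖^-closed⇒core-fixpoint closed = reductive coreUCO _ , ⊖^-closed⇒⊆core closed

    core-least : ∀ (η : UCO) → ρ∀ M ⊑ op η → CompleteFor (op η) ⊕ → core ⊑ op η
    core-least η ρ∀⊑η complete X =
        monotone coreUCO (reductive η X)
      ∘ ⊖^-closed⇒⊆core (fixpoint⇒⊖^-closed η complete ρ∀⊑η (reductive η _ , proj₂ (idempotent η X)))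

    module _ (⊖M⊆M : ⊖ M ⊆ M) where

      ⊖∘core∘⊕⊆core : ∀ X → ⊖ (core (⊕ X)) ⊆ core X
      ⊖∘core∘⊕⊆core X h r = let (m , x) = h (gmap back Jump-back r) in ⊖M⊆M m , ⊖∘⊕⊆id X x

      core∘⊕⊆⊕∘core : ∀ X → core (⊕ X) ⊆ ⊕ (core X)
      core∘⊕⊆⊕∘core X {i , σ} = ⊖∘core∘⊕⊆core X {i + 1ℤ , σ} ∘ id⊆⊕∘⊖ (core (⊕ X)) {i , σ}

      core-complete : CompleteFor core ⊕
      core-complete = subcommuting⇒complete coreUCO ⊕-mono core∘⊕⊆⊕∘core

      core-fixpoint⇒⊖^-closed : ∀ {Y} → IsFixpoint coreUCO Y → ⊖^-Closed (ρ∀ M) Y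
      core-fixpoint⇒⊖^-closed = fixpoint⇒⊖^-closed coreUCO core-complete ρ∀⊑core

theorem6 : ∀ {ℓ} {S : Set ℓ} (M : TSet S) → StandingHyp M →
    Σ[ η ∈ UCO ] (IsCompleteCore (ρ∀ M) ⊕ η
      × (∀ (Y : TSet S) →
          (IsFixpoint η Y → ∀ (k : ℕ) → ⊖^ k Y ≐ ρ∀ M (⊖^ k Y))
          × ((∀ (k : ℕ) → ⊖^ k Y ≐ ρ∀ M (⊖^ k Y)) → IsFixpoint η Y)))
theorem6 M (_ , _ , (⊖M⊆M , _) , _) =
    coreUCO M
  , (ρ∀⊑core M , core-complete M ⊖M⊆M , core-least M)
  , λ Y → (λ fixY k → core-fixpoint⇒⊖^-closed M ⊖M⊆M fixY k , ρ∀-reductive M _)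
        , (λ fixes → ⊖^-closed⇒core-fixpoint M (proj₁ ∘ fixes))
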